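{- Let $t_1,\dots,t_n$ be pairwise different ground terms of $\Sigma$, all of the same depth, and let $\mathit{Con}$ be the contents of some ground term such that $\mathit{Con}$ extends the contents of each $t_i$, $1\le i\le n$. Then there exist at least $n$ different ground terms with contents $\mathit{Con}$.
   Context: $\Sigma$ is a finite signature with at least one constant, enumerated as $g_1,\dots,g_S$. The contents of a ground term $t$ is the tuple $(n_1,\dots,n_S)$ where $n_i$ is the number of occurrences of $g_i$ in $t$. A tuple $(n_1,\dots,n_S)$ extends $(m_1,\dots,m_S)$ if $n_i\ge m_i$ for all $i$. The depth of a constant is $1$, and the depth of $g(t_1,\dots,t_n)$ ($n\ge1$) is $1$ plus the maximum depth of the $t_i$. -}

module Defs where

open import Data.Nat using (ℕ; zero; suc; _+_; _≤_; _⊔_)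
open import Data.Fin using (Fin; _≟_)
open import Data.Vec using (Vec; []; _∷_)
open import Data.Product using (∃)
open import Relation.Binary.PropositionalEquality using (_≡_)
open import Relation.Nullary using (yes; no)

record Signature : Set where
  field
    S        : ℕ
    arity    : Fin S → ℕ
    hasConst : ∃ λ (g : Fin S) → arity g ≡ 0
open Signature public

data Term (Σ : Signature) : Set where
  node : (g : Fin (S Σ)) → Vec (Term Σ) (arity Σ g) → Term Σ

Contents : Signature → Set
Contents Σ = Fin (S Σ) → ℕ

module _ {Σ : Signature} where

  occ : Fin (S Σ) → Term Σ → ℕ
  occs : ∀ {k} → Fin (S Σ) → Vec (Term Σ) k → ℕ
  occ g (node f ts) with g ≟ f
  ... | yes _ = suc (occs g ts)
  ... | no  _ = occs g ts
  occs g [] = 0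
  occs g (t ∷ ts) = occ g t + occs g ts

  contents : Term Σ → Contents Σ
  contents t g = occ g t

  depth : Term Σ → ℕ
  maxDepth : ∀ {k} → Vec (Term Σ) k → ℕ
  depth (node f ts) = suc (maxDepth ts)
  maxDepth [] = 0
  maxDepth (t ∷ ts) = depth t ⊔ maxDepth ts

_extends_ : ∀ {Σ : Signature} → Contents Σ → Contents Σ → Set
n extends m = ∀ i → m i ≤ n i

{-# OPTIONS --safe #-}
-- If Con extends the contents of t, the symbols Con has in excess of t form a multiset D
-- whose total arity equals its size, because every term has exactly one node more than the
-- sum of the arities of its nodes. Nesting t inside the non-constant symbols of D, each
-- taking the previous term as its first argument, with the constants of D filling the
-- remaining argument places, yields a term with contents Con that has t on its leftmost
-- branch. Depths strictly decrease along that branch, so t is the only subterm of its depth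
-- there; as t_1, ..., t_n have the same depth, distinct t_i yield distinct terms.
module Submission where

open import Defs
open import Data.Fin using (Fin) renaming (_≟_ to _≟ᶠ_)
open import Data.List using (List; []; _∷_; _++_; map)
open import Data.List.Properties using (map-++; ++-assoc)
open import Data.Maybe using (Maybe; just; nothing)
open import Data.Maybe.Properties using (just-injective)
open import Data.Nat using (ℕ; zero; suc; _+_; _≤_; _<_; _≟_; s≤s; z≤n)
open import Data.Nat.ListAction using (sum)
open import Data.Nat.ListAction.Properties using (sum-++)
open import Data.Nat.Properties
open import Data.Nat.Tactic.RingSolver using (solve-∀)
open import Data.Product using (Σ-syntax; ∃-syntax; _×_; _,_; proj₁; proj₂)
open import Data.Vec using (Vec; []; _∷_; take; drop) renaming (_++_ to _++ⱽ_)
open import Data.Vec.Properties using (take++drop≡id)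
open import Function using (const)
open import Relation.Binary.Definitions using (DecidableEquality)
open import Relation.Binary.PropositionalEquality
open import Relation.Nullary using (yes; no; contradiction)

open import Algebra.Properties.CommutativeSemigroup +-commutativeSemigroup
  using (interchange; x∙yz≈y∙xz)

-- Lists of symbols stand for multisets: ys is the multiset union of xs and zs when
-- weight m ys ≡ weight m xs + weight m zs for every weight function m.
weight : {A : Set} → (A → ℕ) → List A → ℕ
weight m xs = sum (map m xs)

weight-++ : {A : Set} (m : A → ℕ) (xs ys : List A) →
            weight m (xs ++ ys) ≡ weight m xs + weight m ys
weight-++ m xs ys = trans (cong sum (map-++ m xs ys)) (sum-++ (map m xs) (map m ys))

module Multiplicity {A : Set} (_≟ᴬ_ : DecidableEquality A) where

  δ : A → A → ℕ
  δ a b with a ≟ᴬ b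
  ... | yes _ = 1
  ... | no  _ = 0

  count : A → List A → ℕ
  count a = weight (δ a)

  ∃-without : ∀ {a} xs → 0 < count a xs →
              ∃[ ys ] (∀ m → weight m xs ≡ m a + weight m ys)
  ∃-without {a} (x ∷ xs) a∈xs with a ≟ᴬ x
  ... | yes refl = xs , λ m → refl
  ... | no  _    with ys , xs≡a+ys ← ∃-without xs a∈xs =
    x ∷ ys , λ m → trans (cong (m x +_) (xs≡a+ys m)) (x∙yz≈y∙xz (m x) (m a) _)

  occurs-head : ∀ x xs → 0 < count x (x ∷ xs)
  occurs-head x xs with x ≟ᴬ x
  ... | yes _  = s≤s z≤n
  ... | no x≢x = contradiction refl x≢x

  ∃-complement : ∀ xs ys → (∀ a → count a xs ≤ count a ys) →
                 ∃[ zs ] (∀ m → weight m ys ≡ weight m xs + weight m zs)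
  ∃-complement []       ys _     = ys , λ m → refl
  ∃-complement (x ∷ xs) ys xs⊆ys
    with ys′ , ys≡x+ys′ ← ∃-without ys (≤-trans (occurs-head x xs) (xs⊆ys x))
    with zs , ys′≡xs+zs ← ∃-complement xs ys′ (λ a →
           +-cancelˡ-≤ (δ a x) _ _ (subst (count a (x ∷ xs) ≤_) (ys≡x+ys′ (δ a)) (xs⊆ys a))) =
    zs , λ m → begin
      weight m ys                          ≡⟨ ys≡x+ys′ m ⟩
      m x + weight m ys′                   ≡⟨ cong (m x +_) (ys′≡xs+zs m) ⟩
      m x + (weight m xs + weight m zs)    ≡⟨ +-assoc (m x) _ _ ⟨
      weight m (x ∷ xs) + weight m zs      ∎
    where open ≡-Reasoning

module _ (Sg : Signature) where

  private
    T   = Term Sg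
    Sym = Fin (S Sg)
    ar  = arity Sg

  open Multiplicity (_≟ᶠ_ {S Sg})

  symbols : T → List Sym
  symbolsⱽ : ∀ {k} → Vec T k → List Sym
  symbols (node f ts) = f ∷ symbolsⱽ ts
  symbolsⱽ []       = []
  symbolsⱽ (t ∷ ts) = symbols t ++ symbolsⱽ ts

  symbolsⱽ-++ : ∀ {k l} (ts : Vec T k) (us : Vec T l) →
                symbolsⱽ (ts ++ⱽ us) ≡ symbolsⱽ ts ++ symbolsⱽ us
  symbolsⱽ-++ []       us = refl
  symbolsⱽ-++ (t ∷ ts) us =
    trans (cong (symbols t ++_) (symbolsⱽ-++ ts us)) (sym (++-assoc (symbols t) _ _))

  symbolsⱽ-subst : ∀ {k l} (e : k ≡ l) (ts : Vec T k) → symbolsⱽ (subst (Vec T) e ts) ≡ symbolsⱽ ts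
  symbolsⱽ-subst refl ts = refl

  occ≡weight : ∀ g t → occ g t ≡ count g (symbols t)
  occs≡weight : ∀ {k} g (ts : Vec T k) → occs g ts ≡ count g (symbolsⱽ ts)
  occ≡weight g (node f ts) with g ≟ᶠ f
  ... | yes _ = cong suc (occs≡weight g ts)
  ... | no  _ = occs≡weight g ts
  occs≡weight g []       = refl
  occs≡weight g (t ∷ ts) = begin
    occ g t + occs g ts                          ≡⟨ cong₂ _+_ (occ≡weight g t) (occs≡weight g ts) ⟩
    count g (symbols t) + count g (symbolsⱽ ts)  ≡⟨ weight-++ (δ g) (symbols t) _ ⟨
    count g (symbols t ++ symbolsⱽ ts)           ∎
    where open ≡-Reasoning

  symbols-balanced : ∀ t → weight (const 1) (symbols t) ≡ suc (weight ar (symbols t))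
  symbolsⱽ-balanced : ∀ {k} (ts : Vec T k) → weight (const 1) (symbolsⱽ ts) ≡ k + weight ar (symbolsⱽ ts)
  symbols-balanced (node f ts) = cong suc (symbolsⱽ-balanced ts)
  symbolsⱽ-balanced []               = refl
  symbolsⱽ-balanced {suc k} (t ∷ ts) = begin
    size (symbols t ++ symbolsⱽ ts)                          ≡⟨ weight-++ (const 1) (symbols t) _ ⟩
    size (symbols t) + size (symbolsⱽ ts)                    ≡⟨ cong₂ _+_ (symbols-balanced t) (symbolsⱽ-balanced ts) ⟩
    suc (arities (symbols t)) + (k + arities (symbolsⱽ ts))  ≡⟨ cong suc (x∙yz≈y∙xz (arities (symbols t)) k _) ⟩
    suc k + (arities (symbols t) + arities (symbolsⱽ ts))    ≡⟨ cong (suc k +_) (weight-++ ar (symbols t) _) ⟨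
    suc k + arities (symbols t ++ symbolsⱽ ts)               ∎
    where
    open ≡-Reasoning
    size arities : List Sym → ℕ
    size    = weight (const 1)
    arities = weight ar

  Balanced : List Sym → Set
  Balanced D = weight (const 1) D ≡ weight ar D

  complement-balanced : ∀ t s D → (∀ m → weight m (symbols s) ≡ weight m (symbols t) + weight m D) →
                        Balanced D
  complement-balanced t s D s≡t+D = +-cancelˡ-≡ (suc (weight ar (symbols t))) _ _ (begin
    suc (weight ar (symbols t)) + weight (const 1) D       ≡⟨ cong (_+ weight (const 1) D) (symbols-balanced t) ⟨
    weight (const 1) (symbols t) + weight (const 1) D      ≡⟨ s≡t+D (const 1) ⟨
    weight (const 1) (symbols s)                           ≡⟨ symbols-balanced s ⟩
    suc (weight ar (symbols s))                            ≡⟨ cong suc (s≡t+D ar) ⟩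
    suc (weight ar (symbols t) + weight ar D)              ∎)
    where open ≡-Reasoning

  node≡ : ∀ {k} (f : Sym) → ar f ≡ k → Vec T k → T
  node≡ f refl ts = node f ts

  symbols-node≡ : ∀ {k} f (e : ar f ≡ k) (ts : Vec T k) → symbols (node≡ f e ts) ≡ f ∷ symbolsⱽ ts
  symbols-node≡ f refl ts = refl

  depth-node≡ : ∀ {k} f (e : ar f ≡ k) (ts : Vec T k) → depth (node≡ f e ts) ≡ suc (maxDepth ts)
  depth-node≡ f refl ts = refl

  leftBranchAt : ℕ → T → Maybe T
  leftBranchAtⱽ : ∀ {k} → ℕ → Vec T k → Maybe T
  leftBranchAt d (node f ts) with suc (maxDepth ts) ≟ d
  ... | yes _ = just (node f ts)
  ... | no  _ = leftBranchAtⱽ d ts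
  leftBranchAtⱽ d []      = nothing
  leftBranchAtⱽ d (t ∷ _) = leftBranchAt d t

  leftBranchAt-depth : ∀ t → leftBranchAt (depth t) t ≡ just t
  leftBranchAt-depth (node f ts) with suc (maxDepth ts) ≟ suc (maxDepth ts)
  ... | yes _   = refl
  ... | no  d≢d = contradiction refl d≢d

  leftBranchAt-node≡ : ∀ {k d} f (e : ar f ≡ k) (ts : Vec T k) → d ≢ depth (node≡ f e ts) →
                       leftBranchAt d (node≡ f e ts) ≡ leftBranchAtⱽ d ts
  leftBranchAt-node≡ {d = d} f refl ts d≢ with suc (maxDepth ts) ≟ d
  ... | yes eq = contradiction (sym eq) d≢
  ... | no  _  = refl

  data OnLeftBranch (t : T) : T → Set where
    here  : OnLeftBranch t t
    under : ∀ {f k u} {us : Vec T k} (e : ar f ≡ suc k) →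
            OnLeftBranch t u → OnLeftBranch t (node≡ f e (u ∷ us))

  firstArg-depth< : ∀ {f k u} {us : Vec T k} (e : ar f ≡ suc k) → depth u < depth (node≡ f e (u ∷ us))
  firstArg-depth< {f} {u = u} {us} e =
    subst (depth u <_) (sym (depth-node≡ f e (u ∷ us))) (s≤s (m≤m⊔n (depth u) (maxDepth us)))

  OnLeftBranch-depth : ∀ {t u} → OnLeftBranch t u → depth t ≤ depth u
  OnLeftBranch-depth here        = ≤-refl
  OnLeftBranch-depth (under e p) = <⇒≤ (≤-<-trans (OnLeftBranch-depth p) (firstArg-depth< e))

  OnLeftBranch⇒leftBranchAt : ∀ {t u} → OnLeftBranch t u → leftBranchAt (depth t) u ≡ just t
  OnLeftBranch⇒leftBranchAt {t} here = leftBranchAt-depth t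
  OnLeftBranch⇒leftBranchAt (under {f} {u = u} {us} e p) =
    trans (leftBranchAt-node≡ f e (u ∷ us) (<⇒≢ (≤-<-trans (OnLeftBranch-depth p) (firstArg-depth< e))))
          (OnLeftBranch⇒leftBranchAt p)

  data Kind (f : Sym) : Set where
    constant : ar f ≡ 0 → Kind f
    compound : ∀ k → ar f ≡ suc k → Kind f

  kind : ∀ f → Kind f
  kind f with ar f in e
  ... | zero  = constant e
  ... | suc k = compound k e

  slots : ∀ {f} → Kind f → ℕ
  slots (constant _)   = 0
  slots (compound k _) = k

  leafCount : ∀ {f} → Kind f → ℕ
  leafCount (constant _)   = 1
  leafCount (compound _ _) = 0

  leafCount+arity : ∀ {f} (κ : Kind f) → leafCount κ + ar f ≡ suc (slots κ)
  leafCount+arity (constant e)   = cong suc e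
  leafCount+arity (compound _ e) = e

  leavesOf : ∀ {f} (κ : Kind f) → Vec T (leafCount κ)
  leavesOf {f} (constant e) = node≡ f e [] ∷ []
  leavesOf (compound _ _)   = []

  graft : ∀ {f} (κ : Kind f) → T → Vec T (slots κ) → T
  graft (constant _)       u [] = u
  graft {f} (compound _ e) u vs = node≡ f e (u ∷ vs)

  slotCount : List Sym → ℕ
  slotCount []      = 0
  slotCount (f ∷ D) = slots (kind f) + slotCount D

  leafTotal : List Sym → ℕ
  leafTotal []      = 0
  leafTotal (f ∷ D) = leafCount (kind f) + leafTotal D

  leaves : (D : List Sym) → Vec T (leafTotal D)
  leaves []      = []
  leaves (f ∷ D) = leavesOf (kind f) ++ⱽ leaves D

  spine : (D : List Sym) → T → Vec T (slotCount D) → T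
  spine []      u [] = u
  spine (f ∷ D) u P  = graft (kind f) (spine D u (drop (slots (kind f)) P)) (take (slots (kind f)) P)

  graft-onLeftBranch : ∀ {f t u} (κ : Kind f) (vs : Vec T (slots κ)) →
                       OnLeftBranch t u → OnLeftBranch t (graft κ u vs)
  graft-onLeftBranch (constant _)   [] p = p
  graft-onLeftBranch (compound _ e) vs p = under e p

  spine-onLeftBranch : ∀ {t u} D (P : Vec T (slotCount D)) → OnLeftBranch t u → OnLeftBranch t (spine D u P)
  spine-onLeftBranch []      [] p = p
  spine-onLeftBranch (f ∷ D) P  p = graft-onLeftBranch (kind f) _ (spine-onLeftBranch D _ p)

  leafTotal+arities : ∀ D → leafTotal D + weight ar D ≡ weight (const 1) D + slotCount D
  leafTotal+arities []      = refl
  leafTotal+arities (f ∷ D) = begin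
    (leafCount κ + leafTotal D) + (ar f + weight ar D) ≡⟨ interchange (leafCount κ) _ _ _ ⟩
    (leafCount κ + ar f) + (leafTotal D + weight ar D) ≡⟨ cong₂ _+_ (leafCount+arity κ) (leafTotal+arities D) ⟩
    suc (slots κ + (weight (const 1) D + slotCount D)) ≡⟨ cong suc (x∙yz≈y∙xz (slots κ) (weight (const 1) D) (slotCount D)) ⟩
    suc (weight (const 1) D + (slots κ + slotCount D)) ∎
    where
    open ≡-Reasoning
    κ : Kind f
    κ = kind f

  balanced⇒leafTotal≡slotCount : ∀ D → Balanced D → leafTotal D ≡ slotCount D
  balanced⇒leafTotal≡slotCount D bal =
    +-cancelˡ-≡ (weight ar D) _ _
      (trans (+-comm (weight ar D) _) (trans (leafTotal+arities D) (cong (_+ slotCount D) bal)))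

  wrap : (D : List Sym) → Balanced D → T → T
  wrap D bal u = spine D u (subst (Vec T) (balanced⇒leafTotal≡slotCount D bal) (leaves D))

  wrap-onLeftBranch : ∀ D (bal : Balanced D) u → OnLeftBranch u (wrap D bal u)
  wrap-onLeftBranch D bal u = spine-onLeftBranch D _ here

  module _ (m : Sym → ℕ) where

    private
      ⟦_⟧ : T → ℕ
      ⟦ t ⟧ = weight m (symbols t)
      ⟦_⟧ⱽ : ∀ {k} → Vec T k → ℕ
      ⟦ ts ⟧ⱽ = weight m (symbolsⱽ ts)

    weightⱽ-++ : ∀ {k l} (ts : Vec T k) (us : Vec T l) → ⟦ ts ++ⱽ us ⟧ⱽ ≡ ⟦ ts ⟧ⱽ + ⟦ us ⟧ⱽ
    weightⱽ-++ ts us = trans (cong (weight m) (symbolsⱽ-++ ts us)) (weight-++ m (symbolsⱽ ts) _)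

    graft-weight : ∀ {f} (κ : Kind f) u (vs : Vec T (slots κ)) →
                   ⟦ graft κ u vs ⟧ + ⟦ leavesOf κ ⟧ⱽ ≡ m f + (⟦ u ⟧ + ⟦ vs ⟧ⱽ)
    graft-weight {f} (constant e) u [] rewrite symbols-node≡ f e [] = x∙yz≈y∙xz ⟦ u ⟧ (m f) 0
    graft-weight {f} (compound _ e) u vs = begin
      ⟦ node≡ f e (u ∷ vs) ⟧ + 0                 ≡⟨ +-identityʳ _ ⟩
      weight m (symbols (node≡ f e (u ∷ vs)))    ≡⟨ cong (weight m) (symbols-node≡ f e (u ∷ vs)) ⟩
      m f + weight m (symbols u ++ symbolsⱽ vs)  ≡⟨ cong (m f +_) (weight-++ m (symbols u) _) ⟩
      m f + (⟦ u ⟧ + ⟦ vs ⟧ⱽ)                    ∎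
      where open ≡-Reasoning

    spine-weight : ∀ D u (P : Vec T (slotCount D)) →
                   ⟦ spine D u P ⟧ + ⟦ leaves D ⟧ⱽ ≡ weight m D + (⟦ u ⟧ + ⟦ P ⟧ⱽ)
    spine-weight []      u [] = refl
    spine-weight (f ∷ D) u P  = begin
      ⟦ graft κ u′ vs ⟧ + ⟦ leavesOf κ ++ⱽ leaves D ⟧ⱽ       ≡⟨ cong (⟦ graft κ u′ vs ⟧ +_) (weightⱽ-++ (leavesOf κ) (leaves D)) ⟩
      ⟦ graft κ u′ vs ⟧ + (⟦ leavesOf κ ⟧ⱽ + ⟦ leaves D ⟧ⱽ)  ≡⟨ +-assoc ⟦ graft κ u′ vs ⟧ _ _ ⟨
      ⟦ graft κ u′ vs ⟧ + ⟦ leavesOf κ ⟧ⱽ + ⟦ leaves D ⟧ⱽ    ≡⟨ cong (_+ ⟦ leaves D ⟧ⱽ) (graft-weight κ u′ vs) ⟩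
      m f + (⟦ u′ ⟧ + ⟦ vs ⟧ⱽ) + ⟦ leaves D ⟧ⱽ               ≡⟨ rearrange (m f) ⟦ u′ ⟧ ⟦ vs ⟧ⱽ ⟦ leaves D ⟧ⱽ ⟩
      m f + (⟦ vs ⟧ⱽ + (⟦ u′ ⟧ + ⟦ leaves D ⟧ⱽ))            ≡⟨ cong (λ x → m f + (⟦ vs ⟧ⱽ + x)) (spine-weight D u rest) ⟩
      m f + (⟦ vs ⟧ⱽ + (weight m D + (⟦ u ⟧ + ⟦ rest ⟧ⱽ))) ≡⟨ rearrange′ (m f) ⟦ vs ⟧ⱽ (weight m D) ⟦ u ⟧ ⟦ rest ⟧ⱽ ⟩
      m f + weight m D + (⟦ u ⟧ + (⟦ vs ⟧ⱽ + ⟦ rest ⟧ⱽ))    ≡⟨ cong (λ x → m f + weight m D + (⟦ u ⟧ + x)) (weightⱽ-++ vs rest) ⟨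
      m f + weight m D + (⟦ u ⟧ + ⟦ vs ++ⱽ rest ⟧ⱽ)          ≡⟨ cong (λ Q → m f + weight m D + (⟦ u ⟧ + ⟦ Q ⟧ⱽ)) (take++drop≡id (slots κ) P) ⟩
      m f + weight m D + (⟦ u ⟧ + ⟦ P ⟧ⱽ)                    ∎
      where
      open ≡-Reasoning
      κ : Kind f
      κ = kind f
      vs : Vec T (slots κ)
      vs = take (slots κ) P
      rest : Vec T (slotCount D)
      rest = drop (slots κ) P
      u′ : T
      u′ = spine D u rest
      rearrange : ∀ a b c d → a + (b + c) + d ≡ a + (c + (b + d))
      rearrange = solve-∀
      rearrange′ : ∀ a b c d e → a + (b + (c + (d + e))) ≡ a + c + (d + (b + e))
      rearrange′ = solve-∀

    wrap-weight : ∀ D (bal : Balanced D) u → ⟦ wrap D bal u ⟧ ≡ ⟦ u ⟧ + weight m D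
    wrap-weight D bal u = +-cancelʳ-≡ ⟦ leaves D ⟧ⱽ _ _ (begin
      ⟦ wrap D bal u ⟧ + ⟦ leaves D ⟧ⱽ          ≡⟨ spine-weight D u pool ⟩
      weight m D + (⟦ u ⟧ + ⟦ pool ⟧ⱽ)          ≡⟨ cong (λ x → weight m D + (⟦ u ⟧ + weight m x)) (symbolsⱽ-subst (balanced⇒leafTotal≡slotCount D bal) (leaves D)) ⟩
      weight m D + (⟦ u ⟧ + ⟦ leaves D ⟧ⱽ)      ≡⟨ +-assoc (weight m D) _ _ ⟨
      weight m D + ⟦ u ⟧ + ⟦ leaves D ⟧ⱽ        ≡⟨ cong (_+ ⟦ leaves D ⟧ⱽ) (+-comm (weight m D) _) ⟩
      ⟦ u ⟧ + weight m D + ⟦ leaves D ⟧ⱽ        ∎)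
      where
      open ≡-Reasoning
      pool : Vec T (slotCount D)
      pool = subst (Vec T) (balanced⇒leafTotal≡slotCount D bal) (leaves D)

  embed : (t s : T) → (∀ g → occ g t ≤ occ g s) →
          Σ[ u ∈ T ] (leftBranchAt (depth t) u ≡ just t × (∀ g → occ g u ≡ occ g s))
  embed t s t≤s = wrap D bal t , OnLeftBranch⇒leftBranchAt (wrap-onLeftBranch D bal t) , occ-wrap
    where
    complement : ∃[ D ] (∀ m → weight m (symbols s) ≡ weight m (symbols t) + weight m D)
    complement = ∃-complement (symbols t) (symbols s) λ g →
      subst₂ _≤_ (occ≡weight g t) (occ≡weight g s) (t≤s g)
    D : List Sym
    D = proj₁ complement
    s≡t+D : ∀ m → weight m (symbols s) ≡ weight m (symbols t) + weight m D
    s≡t+D = proj₂ complement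
    bal : Balanced D
    bal = complement-balanced t s D s≡t+D
    occ-wrap : ∀ g → occ g (wrap D bal t) ≡ occ g s
    occ-wrap g = begin
      occ g (wrap D bal t)                   ≡⟨ occ≡weight g (wrap D bal t) ⟩
      count g (symbols (wrap D bal t))       ≡⟨ wrap-weight (δ g) D bal t ⟩
      count g (symbols t) + count g D        ≡⟨ s≡t+D (δ g) ⟨
      count g (symbols s)                    ≡⟨ occ≡weight g s ⟨
      occ g s                                ∎
      where open ≡-Reasoning

lemma17 : (Sg : Signature) (n : ℕ) (t : Fin n → Term Sg)
          → (∀ i j → t i ≡ t j → i ≡ j)
          → (∀ i j → depth (t i) ≡ depth (t j))
          → (s : Term Sg)
          → (∀ i → _extends_ {Sg} (contents s) (contents (t i)))
          → Σ[ u ∈ (Fin n → Term Sg) ]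
              ((∀ i j → u i ≡ u j → i ≡ j) × (∀ i g → contents (u i) g ≡ contents s g))
lemma17 Sg n t t-injective t-depth s s⊒t = u , u-injective , u-contents
  where
  u : Fin n → Term Sg
  u i = proj₁ (embed Sg (t i) s (s⊒t i))
  t-on-u : ∀ i → leftBranchAt Sg (depth (t i)) (u i) ≡ just (t i)
  t-on-u i = proj₁ (proj₂ (embed Sg (t i) s (s⊒t i)))
  u-contents : ∀ i g → contents (u i) g ≡ contents s g
  u-contents i = proj₂ (proj₂ (embed Sg (t i) s (s⊒t i)))
  u-injective : ∀ i j → u i ≡ u j → i ≡ j
  u-injective i j uᵢ≡uⱼ = t-injective i j (just-injective (begin
    just (t i)                          ≡⟨ t-on-u i ⟨
    leftBranchAt Sg (depth (t i)) (u i) ≡⟨ cong₂ (leftBranchAt Sg) (t-depth i j) uᵢ≡uⱼ ⟩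
    leftBranchAt Sg (depth (t j)) (u j) ≡⟨ t-on-u j ⟩
    just (t j)                          ∎))
    where open ≡-Reasoning
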